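{- For every positive integer $n$, $C_{\rm OR}(M(K_n))\ge\sqrt[n]{n^n+1}>n$.
   Context: $K_n$ is the complete graph on $n$ vertices. The Mycielskian $M(G)$ has vertex set $V(G)\times\{0,1\}\cup\{z\}$ and edge set $\{\{(v,0),(w,i)\}:\{v,w\}\in E(G),\ i\in\{0,1\}\}\cup\{\{z,(v,1)\}: v\in V(G)\}$. For a graph $H$, $H^t$ is its $t$-fold OR-power (vertex set $V(H)^t$, two distinct sequences adjacent iff in some coordinate their entries are adjacent in $H$), $\omega$ is the clique number, and $C_{\rm OR}(H)=\lim_{t\to\infty}\sqrt[t]{\omega(H^t)}$. -}

module Defs where

open import Data.Nat as ℕ using (ℕ; zero; suc)
open import Data.Fin using (Fin)
open import Data.Bool using (Bool; true; false)
open import Data.Product using (_×_; _,_; ∃-syntax)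
open import Data.Sum using (_⊎_; inj₁; inj₂)
open import Data.Unit using (⊤; tt)
open import Data.Empty using (⊥)
open import Data.Vec using (Vec; lookup)
open import Data.List using (List; length)
open import Data.List.Relation.Unary.AllPairs using (AllPairs)
open import Data.Integer using (+_)
open import Data.Rational as ℚ using (ℚ; 1ℚ; _/_)
open import Relation.Binary.PropositionalEquality using (_≡_; _≢_)

record Graph : Set₁ where
  field
    V   : Set
    Adj : V → V → Set
open Graph public

K : ℕ → Graph
K n = record { V = Fin n ; Adj = λ i j → i ≢ j }

-- Mycielskian M(G): vertices V(G) × {0,1} ∪ {z}; Bool false = 0, true = 1;
-- inj₂ tt is the apex z.
MV : Graph → Set
MV G = (V G × Bool) ⊎ ⊤

MAdj : (G : Graph) → MV G → MV G → Set
MAdj G (inj₁ (v , false)) (inj₁ (w , _))     = Adj G v w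
MAdj G (inj₁ (v , true))  (inj₁ (w , false)) = Adj G v w
MAdj G (inj₁ (v , true))  (inj₁ (w , true))  = ⊥
MAdj G (inj₂ tt)          (inj₁ (v , true))  = ⊤
MAdj G (inj₁ (v , true))  (inj₂ tt)          = ⊤
MAdj G (inj₂ tt)          (inj₁ (v , false)) = ⊥
MAdj G (inj₁ (v , false)) (inj₂ tt)          = ⊥
MAdj G (inj₂ tt)          (inj₂ tt)          = ⊥

M : Graph → Graph
M G = record { V = MV G ; Adj = MAdj G }

ORPow : Graph → ℕ → Graph
ORPow H t = record
  { V   = Vec (V H) t
  ; Adj = λ u v → (u ≢ v) × (∃[ i ] Adj H (lookup u i) (lookup v i)) }

HasClique : Graph → ℕ → Set
HasClique H k = ∃[ xs ] ((length {A = V H} xs ≡ k) × AllPairs (Adj H) xs)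

_^ℚ_ : ℚ → ℕ → ℚ
q ^ℚ zero  = 1ℚ
q ^ℚ suc t = q ℚ.* (q ^ℚ t)

ℕ→ℚ : ℕ → ℚ
ℕ→ℚ k = (+ k) / 1

{-# OPTIONS --safe #-}
-- Write a vector x ∈ [n]^n into M(K_n)^n taking coordinate i from the second copy of K_n
-- exactly when i ≡ Σ x (mod n). Two such vectors differing in one coordinate only have
-- different checksums, so distinct vectors differ at a coordinate where at most one of them
-- lies in the second copy, and there they are adjacent; every vector is adjacent to the
-- all-apex vector in its marked coordinate. This gives a clique of size n^n + 1 in
-- M(K_n)^n, and since cliques multiply under concatenation, ω(M(K_n)^t) ≥ (n^n+1)^⌊t/n⌋,
-- which eventually exceeds q^t whenever q^n < n^n + 1.
module Submission where

open import Defs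
open import Data.Nat as ℕ
  using (ℕ; zero; suc; _+_; _*_; _^_; _≤_; _<_; _≥_; z≤n; NonZero)
open import Data.Nat.Properties hiding (_≟_)
open import Data.Nat.DivMod
  using (_%_; _/_; %-distribˡ-+; [m+kn]%n≡m%n; m<n⇒m%n≡m; m%n<n; m%n≤n;
         m≡m%n+[m/n]*n; m*n/n≡m; m/n*n≤m; /-monoˡ-≤)
open import Data.Nat.Tactic.RingSolver using (solve-∀)
open import Data.Integer as ℤ using (+_; -[1+_])
import Data.Integer.Properties as ℤ
open import Data.Rational as ℚ using (ℚ; 0ℚ; mkℚ; toℚᵘ)
import Data.Rational.Properties as ℚ
open import Data.Rational.Unnormalised as ℚᵘ using (mkℚᵘ; *≤*; *<*)
import Data.Rational.Unnormalised.Properties as ℚᵘ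
open import Data.Bool using (true; false; T)
open import Data.Unit using (tt)
open import Data.Empty using (⊥-elim)
open import Data.Fin as Fin using (Fin; toℕ; _≟_)
import Data.Fin.Properties as Fin
open import Data.Vec as Vec using (Vec; []; _∷_; lookup; tabulate; replicate; sum)
import Data.Vec.Properties as Vec
open import Data.Vec.Relation.Binary.Pointwise.Extensional using (ext; Pointwise-≡⇒≡)
open import Data.List as List using (List; []; _∷_; length; map; cartesianProductWith; allFin)
import Data.List.Properties as List
open import Data.List.Relation.Unary.All as All using ([])
import Data.List.Relation.Unary.All.Properties as All
open import Data.List.Relation.Unary.AllPairs as AllPairs using (AllPairs; []; _∷_)
import Data.List.Relation.Unary.AllPairs.Properties as AllPairs
open import Data.List.Relation.Unary.Unique.Propositional using (Unique)
import Data.List.Relation.Unary.Unique.Propositional.Properties as Unique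
open import Data.Product using (_×_; _,_; proj₁; proj₂; ∃-syntax)
open import Data.Sum using (inj₁; inj₂)
open import Function using (_∘_)
open import Relation.Nullary using (¬_; yes; no)
open import Relation.Nullary.Decidable using (isYes; ¬?; _→-dec_; toWitness; fromWitness)
open import Relation.Binary.PropositionalEquality

%-congˡ-+ : ∀ {m n} k d .{{_ : NonZero d}} → m % d ≡ n % d → (m + k) % d ≡ (n + k) % d
%-congˡ-+ {m} {n} k d eq = begin
  (m + k) % d          ≡⟨ %-distribˡ-+ m k d ⟩
  (m % d + k % d) % d  ≡⟨ cong (λ x → (x + k % d) % d) eq ⟩
  (n % d + k % d) % d  ≡⟨ %-distribˡ-+ n k d ⟨
  (n + k) % d          ∎
  where open ≡-Reasoning

+-cancelˡ-% : ∀ k {m n} d .{{_ : NonZero d}} → (k + m) % d ≡ (k + n) % d → m % d ≡ n % d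
+-cancelˡ-% k {m} {n} d@(suc d-1) eq = begin
  m % d                  ≡⟨ [m+kn]%n≡m%n m k d ⟨
  (m + k * d) % d        ≡⟨ cong (_% d) (regroup k m d-1) ⟩
  (k + m + k * d-1) % d  ≡⟨ %-congˡ-+ {k + m} {k + n} (k * d-1) d eq ⟩
  (k + n + k * d-1) % d  ≡⟨ cong (_% d) (regroup k n d-1) ⟨
  (n + k * d) % d        ≡⟨ [m+kn]%n≡m%n n k d ⟩
  n % d                  ∎
  where
  open ≡-Reasoning
  regroup : ∀ k x d → x + k * suc d ≡ k + x + k * d
  regroup = solve-∀

%-cancel : ∀ {u v a b} d .{{_ : NonZero d}} → a < d → b < d →
           u % d ≡ v % d → u + b ≡ v + a → a ≡ b
%-cancel {u} {v} {a} {b} d a<d b<d u≡v eq = begin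
  a      ≡⟨ m<n⇒m%n≡m a<d ⟨
  a % d  ≡⟨ +-cancelˡ-% v d v+a≡v+b ⟩
  b % d  ≡⟨ m<n⇒m%n≡m b<d ⟩
  b      ∎
  where
  open ≡-Reasoning
  v+a≡v+b : (v + a) % d ≡ (v + b) % d
  v+a≡v+b = trans (cong (_% d) (sym eq)) (%-congˡ-+ b d u≡v)

^-distribʳ-* : ∀ m n o → (m * n) ^ o ≡ m ^ o * n ^ o
^-distribʳ-* m n zero    = refl
^-distribʳ-* m n (suc o) = begin
  m * n * (m * n) ^ o          ≡⟨ cong (m * n *_) (^-distribʳ-* m n o) ⟩
  m * n * (m ^ o * n ^ o)      ≡⟨ interchange m n (m ^ o) (n ^ o) ⟩
  m * m ^ o * (n * n ^ o)      ∎
  where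
  open ≡-Reasoning
  interchange : ∀ a b x y → a * b * (x * y) ≡ a * x * (b * y)
  interchange = solve-∀

m^n*[m+n]≤m*[1+m]^n : ∀ m n → m ^ n * (m + n) ≤ m * suc m ^ n
m^n*[m+n]≤m*[1+m]^n m zero = ≤-reflexive (l m)
  where
  l : ∀ m → 1 * (m + 0) ≡ m * 1
  l = solve-∀
m^n*[m+n]≤m*[1+m]^n m (suc n) = begin
  m * m ^ n * (m + suc n)    ≡⟨ l₁ m (m ^ n) n ⟩
  m ^ n * (m * (m + suc n))  ≤⟨ *-monoʳ-≤ (m ^ n) (≤-trans (m≤m+n _ n) (≤-reflexive (l₂ m n))) ⟩
  m ^ n * ((m + n) * suc m)  ≡⟨ *-assoc (m ^ n) (m + n) (suc m) ⟨
  m ^ n * (m + n) * suc m    ≤⟨ *-monoˡ-≤ (suc m) (m^n*[m+n]≤m*[1+m]^n m n) ⟩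
  m * suc m ^ n * suc m      ≡⟨ l₃ m (suc m ^ n) ⟩
  m * (suc m * suc m ^ n)    ∎
  where
  open ≤-Reasoning
  l₁ : ∀ m y n → m * y * (m + suc n) ≡ y * (m * (m + suc n))
  l₁ = solve-∀
  l₂ : ∀ m n → m * (m + suc n) + n ≡ (m + n) * suc m
  l₂ = solve-∀
  l₃ : ∀ m y → m * y * suc m ≡ m * (suc m * y)
  l₃ = solve-∀

k*m<n⇒k*m^n≤[1+m]^n : ∀ k m n → k * m < n → k * m ^ n ≤ suc m ^ n
k*m<n⇒k*m^n≤[1+m]^n k zero    (suc n) _ = ≤-trans (≤-reflexive (*-zeroʳ k)) z≤n
k*m<n⇒k*m^n≤[1+m]^n k m@(suc _) n km<n = *-cancelˡ-≤ m (begin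
  m * (k * m ^ n)  ≡⟨ l m k (m ^ n) ⟩
  m ^ n * (k * m)  ≤⟨ *-monoʳ-≤ (m ^ n) (≤-trans (<⇒≤ km<n) (m≤n+m n m)) ⟩
  m ^ n * (m + n)  ≤⟨ m^n*[m+n]≤m*[1+m]^n m n ⟩
  m * suc m ^ n    ∎)
  where
  open ≤-Reasoning
  l : ∀ m k y → m * (k * y) ≡ y * (k * m)
  l = solve-∀

p^t≤[1+p]^n*[p^n]^[t/n] : ∀ p n .{{_ : NonZero n}} t → p ^ t ≤ suc p ^ n * (p ^ n) ^ (t / n)
p^t≤[1+p]^n*[p^n]^[t/n] p n t = begin
  p ^ t                                  ≡⟨ cong (p ^_) (m≡m%n+[m/n]*n t n) ⟩
  p ^ (t % n + t / n * n)                ≡⟨ ^-distribˡ-+-* p (t % n) _ ⟩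
  p ^ (t % n) * p ^ (t / n * n)          ≡⟨ cong (λ e → p ^ (t % n) * p ^ e) (*-comm (t / n) n) ⟩
  p ^ (t % n) * p ^ (n * (t / n))        ≡⟨ cong (p ^ (t % n) *_) (^-*-assoc p n (t / n)) ⟨
  p ^ (t % n) * (p ^ n) ^ (t / n)        ≤⟨ *-monoˡ-≤ _ p^r≤[1+p]^n ⟩
  suc p ^ n * (p ^ n) ^ (t / n)          ∎
  where
  open ≤-Reasoning
  p^r≤[1+p]^n : p ^ (t % n) ≤ suc p ^ n
  p^r≤[1+p]^n = ≤-trans (^-monoˡ-≤ (t % n) (n≤1+n p)) (^-monoʳ-≤ (suc p) (m%n≤n t n))

-- With m = ⌊t/n⌋: p^t ≤ (1+p)^n (p^n)^m, and Bernoulli gives (1 + p^n)^m ≥ (1+p)^n (p^n)^m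
-- as soon as m > (1+p)^n p^n; this is where T comes from.
p^t≤N^[t/n]*D^t-eventually : ∀ p n N D .{{_ : NonZero n}} .{{_ : NonZero D}} →
  p ^ n < N * D ^ n → ∃[ T ] (∀ t → T ≤ t → p ^ t ≤ N ^ (t / n) * D ^ t)
p^t≤N^[t/n]*D^t-eventually p n N D pⁿ<NDⁿ = suc (E * X) * n , bound
  where
  X = p ^ n
  E = suc p ^ n
  bound : ∀ t → suc (E * X) * n ≤ t → p ^ t ≤ N ^ (t / n) * D ^ t
  bound t T≤t = begin
    p ^ t                      ≤⟨ p^t≤[1+p]^n*[p^n]^[t/n] p n t ⟩
    E * X ^ m                  ≤⟨ k*m<n⇒k*m^n≤[1+m]^n E X m EX<m ⟩
    suc X ^ m                  ≤⟨ ^-monoˡ-≤ m pⁿ<NDⁿ ⟩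
    (N * D ^ n) ^ m            ≡⟨ ^-distribʳ-* N (D ^ n) m ⟩
    N ^ m * (D ^ n) ^ m        ≡⟨ cong (N ^ m *_) (^-*-assoc D n m) ⟩
    N ^ m * D ^ (n * m)        ≤⟨ *-monoʳ-≤ (N ^ m) (^-monoʳ-≤ D nm≤t) ⟩
    N ^ m * D ^ t              ∎
    where
    open ≤-Reasoning
    m = t / n
    EX<m : E * X < m
    EX<m = subst (_≤ m) (m*n/n≡m (suc (E * X)) n) (/-monoˡ-≤ n T≤t)
    nm≤t : n * m ≤ t
    nm≤t = ≤-trans (≤-reflexive (*-comm n m)) (m/n*n≤m t n)

[1+m]^k*j≤m^k*m : ∀ m k j → k + j ≡ m → suc m ^ k * j ≤ m ^ k * m
[1+m]^k*j≤m^k*m m zero    j refl = ≤-refl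
[1+m]^k*j≤m^k*m m (suc k) j k+j≡m = begin
  suc m * suc m ^ k * j    ≡⟨ l₁ (suc m ^ k) m j ⟩
  suc m ^ k * (suc m * j)  ≤⟨ *-monoʳ-≤ (suc m ^ k) [1+m]j≤[1+j]m ⟩
  suc m ^ k * (suc j * m)  ≡⟨ *-assoc (suc m ^ k) (suc j) m ⟨
  suc m ^ k * suc j * m    ≤⟨ *-monoˡ-≤ m ([1+m]^k*j≤m^k*m m k (suc j) (trans (+-suc k j) k+j≡m)) ⟩
  m ^ k * m * m            ≡⟨ cong (_* m) (*-comm (m ^ k) m) ⟩
  m * m ^ k * m            ∎
  where
  open ≤-Reasoning
  l₁ : ∀ y m j → suc m * y * j ≡ y * (suc m * j)
  l₁ = solve-∀
  l₂ : ∀ m j → suc j * m ≡ m * j + m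
  l₂ = solve-∀
  [1+m]j≤[1+j]m : suc m * j ≤ suc j * m
  [1+m]j≤[1+j]m = begin
    j + m * j  ≡⟨ +-comm j (m * j) ⟩
    m * j + j  ≤⟨ +-monoʳ-≤ (m * j) (≤-trans (m≤n+m j (suc k)) (≤-reflexive k+j≡m)) ⟩
    m * j + m  ≡⟨ l₂ m j ⟨
    suc j * m  ∎

-- With D = N + 1 the rational (nD + 1)/D exceeds n but has n-th power below N.
[1+n*D]^n<N*D^n : ∀ n .{{_ : NonZero n}} → let N = suc (n ^ n); D = suc N in
  suc (n * D) ^ n < N * D ^ n
[1+n*D]^n<N*D^n n = *-cancelʳ-< (n * N) (suc (n * D) ^ n) (N * D ^ n) (begin-strict
  suc (n * D) ^ n * (n * N)  ≤⟨ [1+m]^k*j≤m^k*m (n * D) n (n * N) (sym (*-suc n N)) ⟩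
  (n * D) ^ n * (n * D)      ≡⟨ cong (_* (n * D)) (^-distribʳ-* n D n) ⟩
  X * D ^ n * (n * D)        ≡⟨ l₁ X (D ^ n) n D ⟩
  D ^ n * n * (X * D)        <⟨ *-monoʳ-< (D ^ n * n) {{m*n≢0 (D ^ n) n {{m^n≢0 D n}}}} XD<NN ⟩
  D ^ n * n * (N * N)        ≡⟨ l₂ N (D ^ n) n ⟩
  N * D ^ n * (n * N)        ∎)
  where
  open ≤-Reasoning
  X = n ^ n
  N = suc X
  D = suc N
  XD<NN : X * D < N * N
  XD<NN = ≤-reflexive (l X)
    where
    l : ∀ X → suc (X * suc (suc X)) ≡ suc X * suc X
    l = solve-∀
  l₁ : ∀ X y n D → X * y * (n * D) ≡ y * n * (X * D)
  l₁ = solve-∀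
  l₂ : ∀ N y n → y * n * (N * N) ≡ N * y * (n * N)
  l₂ = solve-∀

+/-* : ∀ a b c e .{{_ : NonZero b}} .{{_ : NonZero e}} →
       (+ a ℚᵘ./ b) ℚᵘ.* (+ c ℚᵘ./ e) ≡ ((+ (a * c)) ℚᵘ./ (b * e)) {{m*n≢0 b e}}
+/-* a (suc b) c (suc e) = cong (λ z → mkℚᵘ z _) (sym (ℤ.pos-* a c))

+/-≤ : ∀ {a b c e} .{{_ : NonZero b}} .{{_ : NonZero e}} →
       a * e ≤ c * b → + a ℚᵘ./ b ℚᵘ.≤ + c ℚᵘ./ e
+/-≤ {a} {suc b} {c} {suc e} h = *≤* (subst₂ ℤ._≤_ (ℤ.pos-* a (suc e)) (ℤ.pos-* c (suc b)) (ℤ.+≤+ h))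

+/-< : ∀ {a b c e} .{{_ : NonZero b}} .{{_ : NonZero e}} →
       a * e < c * b → + a ℚᵘ./ b ℚᵘ.< + c ℚᵘ./ e
+/-< {a} {suc b} {c} {suc e} h = *<* (subst₂ ℤ._<_ (ℤ.pos-* a (suc e)) (ℤ.pos-* c (suc b)) (ℤ.+<+ h))

+/-<⁻¹ : ∀ {a b c e} .{{_ : NonZero b}} .{{_ : NonZero e}} →
         + a ℚᵘ./ b ℚᵘ.< + c ℚᵘ./ e → a * e < c * b
+/-<⁻¹ {a} {suc b} {c} {suc e} (*<* h) =
  ℤ.drop‿+<+ (subst₂ ℤ._<_ (sym (ℤ.pos-* a (suc e))) (sym (ℤ.pos-* c (suc b))) h)

toℚᵘ-/ : ∀ a b .{{_ : NonZero b}} → toℚᵘ (+ a ℚ./ b) ℚᵘ.≃ + a ℚᵘ./ b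
toℚᵘ-/ a (suc b) = ℚ.toℚᵘ-fromℚᵘ (mkℚᵘ (+ a) b)

toℚᵘ-^ℚ : ∀ {q p D} .{{_ : NonZero D}} → toℚᵘ q ℚᵘ.≃ + p ℚᵘ./ D →
          ∀ t → toℚᵘ (q ^ℚ t) ℚᵘ.≃ (+ (p ^ t) ℚᵘ./ (D ^ t)) {{m^n≢0 D t}}
toℚᵘ-^ℚ q≃p/D zero = ℚᵘ.≃-refl
toℚᵘ-^ℚ {q} {p} {D} q≃p/D (suc t) = begin
  toℚᵘ (q ℚ.* q ^ℚ t)                              ≈⟨ ℚ.toℚᵘ-homo-* q (q ^ℚ t) ⟩
  toℚᵘ q ℚᵘ.* toℚᵘ (q ^ℚ t)                        ≈⟨ ℚᵘ.*-cong q≃p/D (toℚᵘ-^ℚ q≃p/D t) ⟩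
  (+ p ℚᵘ./ D) ℚᵘ.* (+ (p ^ t) ℚᵘ./ (D ^ t)) {{m^n≢0 D t}}
    ≡⟨ +/-* p D (p ^ t) (D ^ t) {{_}} {{m^n≢0 D t}} ⟩
  (+ (p ^ suc t) ℚᵘ./ (D ^ suc t)) {{m^n≢0 D (suc t)}}
    ∎
  where open ℚᵘ.≃-Reasoning

module _ {q : ℚ} {p D : ℕ} .{{_ : NonZero D}} (q≃p/D : toℚᵘ q ℚᵘ.≃ + p ℚᵘ./ D) where

  ^ℚ≤ℕ→ℚ : ∀ t k → p ^ t ≤ k * D ^ t → q ^ℚ t ℚ.≤ ℕ→ℚ k
  ^ℚ≤ℕ→ℚ t k h = ℚ.toℚᵘ-cancel-≤
    (ℚᵘ.≤-respˡ-≃ (ℚᵘ.≃-sym (toℚᵘ-^ℚ q≃p/D t)) (ℚᵘ.≤-respʳ-≃ (ℚᵘ.≃-sym (toℚᵘ-/ k 1))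
      (+/-≤ {{m^n≢0 D t}} (subst (_≤ _) (sym (*-identityʳ (p ^ t))) h))))

  ^ℚ<ℕ→ℚ : ∀ t k → p ^ t < k * D ^ t → q ^ℚ t ℚ.< ℕ→ℚ k
  ^ℚ<ℕ→ℚ t k h = ℚ.toℚᵘ-cancel-<
    (ℚᵘ.<-respˡ-≃ (ℚᵘ.≃-sym (toℚᵘ-^ℚ q≃p/D t)) (ℚᵘ.<-respʳ-≃ (ℚᵘ.≃-sym (toℚᵘ-/ k 1))
      (+/-< {{m^n≢0 D t}} (subst (_< _) (sym (*-identityʳ (p ^ t))) h))))

  ^ℚ<ℕ→ℚ⁻¹ : ∀ t k → q ^ℚ t ℚ.< ℕ→ℚ k → p ^ t < k * D ^ t
  ^ℚ<ℕ→ℚ⁻¹ t k h = subst (_< _) (*-identityʳ (p ^ t)) (+/-<⁻¹ {{m^n≢0 D t}}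
    (ℚᵘ.<-respˡ-≃ (toℚᵘ-^ℚ q≃p/D t) (ℚᵘ.<-respʳ-≃ (toℚᵘ-/ k 1) (ℚ.toℚᵘ-mono-< h))))

  ℕ→ℚ< : ∀ k → k * D < p → ℕ→ℚ k ℚ.< q
  ℕ→ℚ< k h = ℚ.toℚᵘ-cancel-<
    (ℚᵘ.<-respˡ-≃ (ℚᵘ.≃-sym (toℚᵘ-/ k 1)) (ℚᵘ.<-respʳ-≃ (ℚᵘ.≃-sym q≃p/D)
      (+/-< (subst (k * D <_) (sym (*-identityʳ p)) h))))

length-cartesianProductWith : ∀ {A B C : Set} (f : A → B → C) xs ys →
  length (cartesianProductWith f xs ys) ≡ length xs * length ys
length-cartesianProductWith f []       ys = refl
length-cartesianProductWith f (x ∷ xs) ys = begin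
  length (map (f x) ys List.++ cartesianProductWith f xs ys)
    ≡⟨ List.length-++ (map (f x) ys) ⟩
  length (map (f x) ys) + length (cartesianProductWith f xs ys)
    ≡⟨ cong₂ _+_ (List.length-map (f x) ys) (length-cartesianProductWith f xs ys) ⟩
  length ys + length xs * length ys
    ∎
  where open ≡-Reasoning

AllPairs-cartesianProductWith⁺ : ∀ {A B C : Set} {R : A → A → Set} {S : B → B → Set}
  {U : C → C → Set} (f : A → B → C) →
  (∀ {x x′ y y′} → R x x′ → U (f x y) (f x′ y′)) →
  (∀ {x y y′} → S y y′ → U (f x y) (f x y′)) →
  ∀ {xs ys} → AllPairs R xs → AllPairs S ys → AllPairs U (cartesianProductWith f xs ys)
AllPairs-cartesianProductWith⁺ f left right [] Sys = []
AllPairs-cartesianProductWith⁺ f left right {x ∷ xs} {ys} (Rx ∷ Rxs) Sys =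
  AllPairs.++⁺ (AllPairs.map⁺ (AllPairs.map right Sys))
    (AllPairs-cartesianProductWith⁺ f left right Rxs Sys)
    (All.map⁺ (All.tabulate λ _ → All.cartesianProductWith⁺ (setoid _) (setoid _) f xs ys
      λ x′∈xs _ → left (All.lookup Rx x′∈xs)))

module _ (H : Graph) where

  ORPow-adj : (∀ v → ¬ Adj H v v) → ∀ {t} {u v : Vec (V H) t} i →
              Adj H (lookup u i) (lookup v i) → Adj (ORPow H t) u v
  ORPow-adj irrefl {v = v} i h = (λ { refl → irrefl (lookup v i) h }) , i , h

  ORPow-adj-++ˡ : ∀ {a b} {u u′ : Vec (V H) a} {v v′ : Vec (V H) b} →
    Adj (ORPow H a) u u′ → Adj (ORPow H (a + b)) (u Vec.++ v) (u′ Vec.++ v′)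
  ORPow-adj-++ˡ {b = b} {u} {u′} {v} {v′} (u≢u′ , i , h) =
    (u≢u′ ∘ Vec.++-injectiveˡ u u′) , i Fin.↑ˡ b ,
    subst₂ (Adj H) (sym (Vec.lookup-++ˡ u v i)) (sym (Vec.lookup-++ˡ u′ v′ i)) h

  ORPow-adj-++ʳ : ∀ {a b} {u : Vec (V H) a} {v v′ : Vec (V H) b} →
    Adj (ORPow H b) v v′ → Adj (ORPow H (a + b)) (u Vec.++ v) (u Vec.++ v′)
  ORPow-adj-++ʳ {a} {u = u} {v} {v′} (v≢v′ , i , h) =
    (v≢v′ ∘ Vec.++-injectiveʳ u u) , a Fin.↑ʳ i ,
    subst₂ (Adj H) (sym (Vec.lookup-++ʳ u v i)) (sym (Vec.lookup-++ʳ u v′ i)) h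

  HasClique-ORPow-+ : ∀ {a b k l} → HasClique (ORPow H a) k → HasClique (ORPow H b) l →
                      HasClique (ORPow H (a + b)) (k * l)
  HasClique-ORPow-+ (xs , ∣xs∣≡k , cx) (ys , ∣ys∣≡l , cy) =
    cartesianProductWith Vec._++_ xs ys ,
    trans (length-cartesianProductWith Vec._++_ xs ys) (cong₂ _*_ ∣xs∣≡k ∣ys∣≡l) ,
    AllPairs-cartesianProductWith⁺ Vec._++_ ORPow-adj-++ˡ ORPow-adj-++ʳ cx cy

  HasClique-ORPow-* : ∀ {a k} → HasClique (ORPow H a) k → ∀ m → HasClique (ORPow H (m * a)) (k ^ m)
  HasClique-ORPow-* c zero    = [] ∷ [] , refl , [] ∷ []
  HasClique-ORPow-* c (suc m) = HasClique-ORPow-+ c (HasClique-ORPow-* c m)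

  HasClique-ORPow-1 : V H → ∀ t → HasClique (ORPow H t) 1
  HasClique-ORPow-1 v t = replicate t v ∷ [] , refl , [] ∷ []

  HasClique-ORPow-/ : V H → ∀ {a k} .{{_ : NonZero a}} → HasClique (ORPow H a) k →
                      ∀ t → HasClique (ORPow H t) (k ^ (t / a))
  HasClique-ORPow-/ v {a} {k} c t = subst₂ (λ s j → HasClique (ORPow H s) j)
    (sym (trans (m≡m%n+[m/n]*n t a) (+-comm (t % a) _))) (*-identityʳ (k ^ (t / a)))
    (HasClique-ORPow-+ (HasClique-ORPow-* c (t / a)) (HasClique-ORPow-1 v (t % a)))

module _ (G : Graph) where

  MAdj-irrefl : (∀ v → ¬ Adj G v v) → ∀ x → ¬ MAdj G x x
  MAdj-irrefl irrefl (inj₁ (v , false)) = irrefl v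
  MAdj-irrefl irrefl (inj₁ (v , true))  ()
  MAdj-irrefl irrefl (inj₂ tt)          ()

  MAdj-copies : ∀ {v w b b′} → Adj G v w → ¬ (T b × T b′) → MAdj G (inj₁ (v , b)) (inj₁ (w , b′))
  MAdj-copies {b = false}               h _    = h
  MAdj-copies {b = true}  {b′ = false}  h _    = h
  MAdj-copies {b = true}  {b′ = true}   _ ¬tt  = ⊥-elim (¬tt (tt , tt))

  MAdj-apex : ∀ {v b} → T b → MAdj G (inj₂ tt) (inj₁ (v , b))
  MAdj-apex {b = true} _ = tt

-- A clique of size n^n + 1 in M(K_n)^n

allVecs : ∀ n k → List (Vec (Fin n) k)
allVecs n zero    = [] ∷ []
allVecs n (suc k) = cartesianProductWith _∷_ (allFin n) (allVecs n k)

length-allVecs : ∀ n k → length (allVecs n k) ≡ n ^ k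
length-allVecs n zero    = refl
length-allVecs n (suc k) = trans (length-cartesianProductWith _∷_ (allFin n) (allVecs n k))
  (cong₂ _*_ (List.length-tabulate {n = n} (λ i → i)) (length-allVecs n k))

allVecs-unique : ∀ n k → Unique (allVecs n k)
allVecs-unique n zero    = [] ∷ []
allVecs-unique n (suc k) = Unique.cartesianProductWith⁺ _∷_ Vec.∷-injective
  (Unique.allFin⁺ n) (allVecs-unique n k)

lookup-≢ : ∀ {n k} {x y : Vec (Fin n) k} → x ≢ y → ∃[ i ] lookup x i ≢ lookup y i
lookup-≢ {k = k} {x} {y} x≢y =
  Fin.¬∀⟶∃¬ k _ (λ i → lookup x i ≟ lookup y i) (x≢y ∘ Pointwise-≡⇒≡ ∘ ext)

module Mycielski (n : ℕ) .{{_ : NonZero n}} where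

  digitSum : ∀ {k} → Vec (Fin n) k → ℕ
  digitSum x = sum (Vec.map toℕ x)

  checksum : Vec (Fin n) n → Fin n
  checksum x = Fin.fromℕ< (m%n<n (digitSum x) n)

  digitSum-swap : ∀ {k} (x y : Vec (Fin n) k) i → (∀ j → j ≢ i → lookup x j ≡ lookup y j) →
    digitSum x + toℕ (lookup y i) ≡ digitSum y + toℕ (lookup x i)
  digitSum-swap (a ∷ x) (b ∷ y) Fin.zero agree = begin
    toℕ a + digitSum x + toℕ b  ≡⟨ cong (λ s → toℕ a + digitSum s + toℕ b) x≡y ⟩
    toℕ a + digitSum y + toℕ b  ≡⟨ swap (toℕ a) (digitSum y) (toℕ b) ⟩
    toℕ b + digitSum y + toℕ a  ∎
    where
    open ≡-Reasoning
    x≡y : x ≡ y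
    x≡y = Pointwise-≡⇒≡ (ext λ j → agree (Fin.suc j) λ ())
    swap : ∀ a s b → a + s + b ≡ b + s + a
    swap = solve-∀
  digitSum-swap (a ∷ x) (b ∷ y) (Fin.suc i) agree = begin
    toℕ a + digitSum x + toℕ (lookup y i)    ≡⟨ +-assoc (toℕ a) (digitSum x) _ ⟩
    toℕ a + (digitSum x + toℕ (lookup y i))  ≡⟨ cong₂ _+_ (cong toℕ (agree Fin.zero λ ())) tails ⟩
    toℕ b + (digitSum y + toℕ (lookup x i))  ≡⟨ +-assoc (toℕ b) (digitSum y) _ ⟨
    toℕ b + digitSum y + toℕ (lookup x i)    ∎
    where
    open ≡-Reasoning
    tails : digitSum x + toℕ (lookup y i) ≡ digitSum y + toℕ (lookup x i)
    tails = digitSum-swap x y i λ j j≢i → agree (Fin.suc j) (j≢i ∘ Fin.suc-injective)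

  checksum-determines : ∀ {x y} i → checksum x ≡ checksum y →
    (∀ j → j ≢ i → lookup x j ≡ lookup y j) → lookup x i ≡ lookup y i
  checksum-determines {x} {y} i eq agree = Fin.toℕ-injective
    (%-cancel n (Fin.toℕ<n (lookup x i)) (Fin.toℕ<n (lookup y i)) sums≡ (digitSum-swap x y i agree))
    where
    sums≡ : digitSum x % n ≡ digitSum y % n
    sums≡ = trans (sym (Fin.toℕ-fromℕ< (m%n<n (digitSum x) n)))
              (trans (cong toℕ eq) (Fin.toℕ-fromℕ< (m%n<n (digitSum y) n)))

  second-difference : ∀ {x y} i → checksum x ≡ checksum y → lookup x i ≢ lookup y i →
    ∃[ j ] (j ≢ i × lookup x j ≢ lookup y j)
  second-difference {x} {y} i eq xᵢ≢yᵢ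
    with Fin.¬∀⟶∃¬ n _ (λ j → ¬? (j ≟ i) →-dec (lookup x j ≟ lookup y j))
           (xᵢ≢yᵢ ∘ checksum-determines {x} {y} i eq)
  ... | j , ¬agree = j , (λ j≡i → ¬agree λ j≢i → ⊥-elim (j≢i j≡i)) , λ xⱼ≡yⱼ → ¬agree λ _ → xⱼ≡yⱼ

  unmarked-difference : ∀ {x y} → x ≢ y →
    ∃[ i ] (lookup x i ≢ lookup y i × ¬ (i ≡ checksum x × i ≡ checksum y))
  unmarked-difference {x} {y} x≢y with lookup-≢ x≢y
  ... | i , xᵢ≢yᵢ with i ≟ checksum x | i ≟ checksum y
  ...   | no i≢cx | _       = i , xᵢ≢yᵢ , i≢cx ∘ proj₁
  ...   | yes _   | no i≢cy = i , xᵢ≢yᵢ , i≢cy ∘ proj₂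
  ...   | yes i≡cx | yes i≡cy with second-difference {x} {y} i (trans (sym i≡cx) i≡cy) xᵢ≢yᵢ
  ...     | j , j≢i , xⱼ≢yⱼ = j , xⱼ≢yⱼ , λ (j≡cx , _) → j≢i (trans j≡cx (sym i≡cx))

  H : Graph
  H = M (K n)

  K-irrefl : ∀ v → ¬ Adj (K n) v v
  K-irrefl v v≢v = v≢v refl

  mark : Vec (Fin n) n → Vec (V H) n
  mark x = tabulate λ i → inj₁ (lookup x i , isYes (i ≟ checksum x))

  apex : Vec (V H) n
  apex = replicate n (inj₂ tt)

  lookup-mark : ∀ x i → lookup (mark x) i ≡ inj₁ (lookup x i , isYes (i ≟ checksum x))
  lookup-mark x = Vec.lookup∘tabulate _

  mark-adj : ∀ {x y} → x ≢ y → Adj (ORPow H n) (mark x) (mark y)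
  mark-adj {x} {y} x≢y with unmarked-difference x≢y
  ... | i , xᵢ≢yᵢ , unmarked = ORPow-adj H (MAdj-irrefl (K n) K-irrefl) i
    (subst₂ (MAdj (K n)) (sym (lookup-mark x i)) (sym (lookup-mark y i))
      (MAdj-copies (K n) {b = isYes (i ≟ checksum x)} {isYes (i ≟ checksum y)} xᵢ≢yᵢ
        λ (tx , ty) → unmarked (toWitness tx , toWitness ty)))

  apex-adj : ∀ x → Adj (ORPow H n) apex (mark x)
  apex-adj x = ORPow-adj H (MAdj-irrefl (K n) K-irrefl) (checksum x)
    (subst₂ (MAdj (K n)) (sym (Vec.lookup-replicate (checksum x) (inj₂ tt)))
      (sym (lookup-mark x (checksum x)))
      (MAdj-apex (K n) {b = isYes (checksum x ≟ checksum x)} (fromWitness refl)))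

  clique : HasClique (ORPow H n) (suc (n ^ n))
  clique = apex ∷ map mark (allVecs n n) ,
    cong suc (trans (List.length-map mark (allVecs n n)) (length-allVecs n n)) ,
    All.map⁺ (All.tabulate λ {x} _ → apex-adj x) ∷
      AllPairs.map⁺ (AllPairs.map mark-adj (allVecs-unique n n))

corollary1 : (n : ℕ) → n ≥ 1 →
    ( (q : ℚ) → 0ℚ ℚ.≤ q → q ^ℚ n ℚ.< ℕ→ℚ (suc (n ℕ.^ n)) →
        ∃[ T ] ((t : ℕ) → t ≥ T →
          ∃[ k ] (HasClique (ORPow (M (K n)) t) k × q ^ℚ t ℚ.≤ ℕ→ℚ k)) )
    × (∃[ r ] (ℕ→ℚ n ℚ.< r × r ^ℚ n ℚ.< ℕ→ℚ (suc (n ℕ.^ n))))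
corollary1 n@(suc _) _ = growth , root
  where
  N = suc (n ^ n)
  D = suc N
  growth : (q : ℚ) → 0ℚ ℚ.≤ q → q ^ℚ n ℚ.< ℕ→ℚ N →
    ∃[ T ] ((t : ℕ) → t ≥ T → ∃[ k ] (HasClique (ORPow (M (K n)) t) k × q ^ℚ t ℚ.≤ ℕ→ℚ k))
  growth (mkℚ -[1+ _ ] _ _) (ℚ.*≤* ()) _
  growth q@(mkℚ (+ p) d-1 _) _ qⁿ<N
    with p^t≤N^[t/n]*D^t-eventually p n N (suc d-1) (^ℚ<ℕ→ℚ⁻¹ {q} ℚᵘ.≃-refl n N qⁿ<N)
  ... | T , bound = T , λ t T≤t →
    N ^ (t / n) , HasClique-ORPow-/ (M (K n)) (inj₂ tt) (Mycielski.clique n) t ,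
    ^ℚ≤ℕ→ℚ {q} ℚᵘ.≃-refl t (N ^ (t / n)) (bound t T≤t)
  root : ∃[ r ] (ℕ→ℚ n ℚ.< r × r ^ℚ n ℚ.< ℕ→ℚ N)
  root = + suc (n * D) ℚ./ D ,
    ℕ→ℚ< (toℚᵘ-/ _ D) n ≤-refl ,
    ^ℚ<ℕ→ℚ (toℚᵘ-/ _ D) n N ([1+n*D]^n<N*D^n n)
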